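{- For every integer $k\ge 2$, the formal power series $$F_k(x,p,q):=\sum_{n\ge 1}x^n\sum_{w\in\mathcal F_{n,k}}p^{\mathrm{sper}(P(w))}q^{\mathrm{area}(P(w))}$$ is equal to $$F_k(x,p,q)=\frac{p^2\left((q+pq^2)x-(pq^3-p^2q^3)x^2-p^kq^{2k}x^k-p^{k+1}q^{2k+1}x^{k+1}\right)}{1-(pq+pq^2)x+(p^2q^3-p^3q^3)x^2+p^{k+2}q^{2k+1}x^{k+1}}.$$
   Context: For integers $k\ge 2$ and $n\ge 1$, $\mathcal F_{n,k}$ denotes the set of binary words $w=w_1\cdots w_n\in\{0,1\}^n$ that do not contain $k$ consecutive $1$'s ($k$-bonacci words). To $w\in\mathcal F_{n,k}$ one associates the bargraph polyomino $P(w)$ (a $k$-bonacci polyomino): $n$ columns of unit cells standing side by side on a common horizontal base line, the $i$-th column consisting of $w_i+1$ cells, i.e. $P(w)$ is the union of the unit squares $[i-1,i]\times[j-1,j]$ for $1\le i\le n$, $1\le j\le w_i+1$. $\mathrm{area}(P)$ is the number of cells of $P$ and $\mathrm{sper}(P)$ is its semiperimeter (half of its perimeter). -}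

module Defs where

open import Data.Bool using (Bool; true; false)
import Data.Bool as B
open import Data.Nat as ℕ using (ℕ; zero; suc; _∸_; ⌊_/2⌋)
import Data.Nat.Properties as ℕP
open import Data.Integer as ℤ using (ℤ; +_; 0ℤ; 1ℤ)
open import Data.List using (List; []; _∷_; map; length; filter; replicate; _++_)
open import Data.Nat.ListAction using (sum)
open import Data.List.Relation.Binary.Infix.Heterogeneous using (Infix)
open import Data.List.Relation.Binary.Infix.Heterogeneous.Properties using (infix?)
open import Data.Product using (_×_)
open import Relation.Nullary using (¬_; Dec)
open import Relation.Nullary.Decidable using (¬?; _×-dec_)
open import Relation.Binary.PropositionalEquality using (_≡_)

allWords : ℕ → List (List Bool)
allWords zero    = [] ∷ []
allWords (suc n) = map (false ∷_) (allWords n) ++ map (true ∷_) (allWords n)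

Contains1^ : ℕ → List Bool → Set
Contains1^ k w = Infix _≡_ (replicate k true) w

IsKBonacci : ℕ → List Bool → Set
IsKBonacci k w = ¬ Contains1^ k w

isKBonacci? : ∀ k w → Dec (IsKBonacci k w)
isKBonacci? k w = ¬? (infix? B._≟_ (replicate k true) w)

-- The bargraph polyomino P(w): column i has height w_i + 1

bit : Bool → ℕ
bit false = 0
bit true  = 1

heights : List Bool → List ℕ
heights w = map (λ b → suc (bit b)) w

area : List Bool → ℕ
area w = sum (heights w)

vertEdges : ℕ → List ℕ → ℕ
vertEdges prev []       = prev ∸ 0
vertEdges prev (h ∷ hs) = (h ∸ prev) ℕ.+ (prev ∸ h) ℕ.+ vertEdges h hs

-- perimeter = number of unit edges on the boundary: each column
-- contributes one bottom and one top horizontal edge, plus exposed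
-- vertical edges |h_{i} - h_{i+1}| (with h_0 = h_{n+1} = 0)
perimeter : List Bool → ℕ
perimeter w = 2 ℕ.* length w ℕ.+ vertEdges 0 (heights w)

sper : List Bool → ℕ
sper w = ⌊ perimeter w /2⌋

-- Formal power series in x, p, q with integer coefficients:
-- s n i j = coefficient of x^n p^i q^j

Series : Set
Series = ℕ → ℕ → ℕ → ℤ

sumTo : ℕ → (ℕ → ℤ) → ℤ
sumTo zero    f = f 0
sumTo (suc m) f = sumTo m f ℤ.+ f (suc m)

_⊕_ : Series → Series → Series
(s ⊕ t) n i j = s n i j ℤ.+ t n i j

_⊖_ : Series → Series → Series
(s ⊖ t) n i j = s n i j ℤ.- t n i j

_⊛_ : Series → Series → Series
(s ⊛ t) n i j =
  sumTo n λ a → sumTo i λ b → sumTo j λ c →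
    s a b c ℤ.* t (n ∸ a) (i ∸ b) (j ∸ c)

infixl 6 _⊕_ _⊖_
infixl 7 _⊛_
infixr 8 _^^_

isZero : ℕ → ℤ
isZero zero    = 1ℤ
isZero (suc _) = 0ℤ

𝟙 X P Q : Series
𝟙 n i j = isZero n ℤ.* isZero i ℤ.* isZero j
X n i j = isZero (n ∸ 1) ℤ.* isZero (1 ∸ n) ℤ.* isZero i ℤ.* isZero j
P n i j = isZero n ℤ.* isZero (i ∸ 1) ℤ.* isZero (1 ∸ i) ℤ.* isZero j
Q n i j = isZero n ℤ.* isZero i ℤ.* isZero (j ∸ 1) ℤ.* isZero (1 ∸ j)

_^^_ : Series → ℕ → Series
s ^^ zero  = 𝟙
s ^^ suc m = s ⊛ (s ^^ m)

count : ℕ → ℕ → ℕ → ℕ → ℕ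
count k n i j =
  length (filter (λ w → isKBonacci? k w ×-dec (sper w ℕP.≟ i) ×-dec (area w ℕP.≟ j))
                 (allWords n))

F : ℕ → Series
F k zero    i j = 0ℤ
F k (suc n) i j = + count k (suc n) i j

Num : ℕ → Series
Num k = P ^^ 2 ⊛ ( (Q ⊕ P ⊛ Q ^^ 2) ⊛ X
                 ⊖ (P ⊛ Q ^^ 3 ⊖ P ^^ 2 ⊛ Q ^^ 3) ⊛ X ^^ 2
                 ⊖ P ^^ k ⊛ Q ^^ (2 ℕ.* k) ⊛ X ^^ k
                 ⊖ P ^^ (k ℕ.+ 1) ⊛ Q ^^ (2 ℕ.* k ℕ.+ 1) ⊛ X ^^ (k ℕ.+ 1))

Den : ℕ → Series
Den k = 𝟙 ⊖ (P ⊛ Q ⊕ P ⊛ Q ^^ 2) ⊛ X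
          ⊕ (P ^^ 2 ⊛ Q ^^ 3 ⊖ P ^^ 3 ⊛ Q ^^ 3) ⊛ X ^^ 2
          ⊕ P ^^ (k ℕ.+ 2) ⊛ Q ^^ (2 ℕ.* k ℕ.+ 1) ⊛ X ^^ (k ℕ.+ 1)

-- The semiperimeter of P(w) is n + 1 plus the number of runs of 1's in w, since vertical
-- boundary edges are traversed as often upwards as downwards. Let G_r be the generating
-- function of the words w for which 1^r w is k-bonacci, p counting the contribution of w to
-- the semiperimeter. Reading the first letter of w gives, for r < k,
--   G_r = U + x p^{b_r} q^2 G_{r+1},   U = p + x p q G_0,   b_0 = 2, b_r = 1 for r > 0,
-- and G_k = 0. With y = x p q^2, telescoping G_1, ..., G_{k-1} yields (1 - y) G_1 = (1 - y^{k-1}) U,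
-- hence (1 - y) G_0 = (1 - y) U + x p^2 q^2 (1 - y^{k-1}) U, a linear equation for G_0 = F_k + p
-- which rearranges to Den_k F_k = Num_k. Products with monomials x^a p^b q^c are shifts of
-- coefficients, so all of this is an identity between finitely many shifted coefficients.

module Submission where

open import Defs
open import Data.Nat using (ℕ; _≥_)
open import Relation.Binary.PropositionalEquality using (_≡_)

open import Data.Nat as ℕ using (zero; suc; _∸_; _≤_; _<_; z≤n; s≤s; _<ᵇ_; ⌊_/2⌋)
import Data.Nat.Properties as ℕP
import Data.Nat.Tactic.RingSolver as ℕSolver
open import Data.Integer using (ℤ; _+_; _-_; _*_; 0ℤ; 1ℤ)
import Data.Integer as ℤ
import Data.Integer.Properties as ℤP
open import Data.Integer.Tactic.RingSolver using (solve-∀)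
open import Data.Bool using (Bool; true; false; not; if_then_else_)
open import Data.List using (List; []; _∷_; map; length; filter; replicate; _++_)
open import Data.List.Properties using (length-replicate; ++-identityʳ)
open import Data.List.Relation.Binary.Infix.Heterogeneous using (Infix; here; there; _++ⁱ_)
open import Data.List.Relation.Binary.Infix.Heterogeneous.Properties using (length-mono)
open import Data.List.Relation.Binary.Prefix.Heterogeneous using (Prefix; []; _∷_; _++ᵖ_)
import Data.List.Relation.Binary.Prefix.Heterogeneous.Properties as Prefix
open import Data.Product using (_×_)
open import Data.Sum using (_⊎_; inj₁; inj₂; [_,_]′; map₁)
open import Data.Empty using (⊥-elim)
open import Relation.Nullary using (¬_; Dec; yes; no; does)
open import Relation.Nullary.Decidable using (_×-dec_)
open import Relation.Binary.PropositionalEquality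
  using (refl; sym; trans; cong; cong₂; subst; subst₂; module ≡-Reasoning)
open ≡-Reasoning

infix 4 _≈_
_≈_ : Series → Series → Set
s ≈ t = ∀ n i j → s n i j ≡ t n i j

≈-refl : ∀ {s} → s ≈ s
≈-refl _ _ _ = refl

≈-trans : ∀ {s t u} → s ≈ t → t ≈ u → s ≈ u
≈-trans e f n i j = trans (e n i j) (f n i j)

⊕-cong : ∀ {s s′ t t′} → s ≈ s′ → t ≈ t′ → s ⊕ t ≈ s′ ⊕ t′
⊕-cong e f n i j = cong₂ _+_ (e n i j) (f n i j)

⊖-cong : ∀ {s s′ t t′} → s ≈ s′ → t ≈ t′ → s ⊖ t ≈ s′ ⊖ t′
⊖-cong e f n i j = cong₂ _-_ (e n i j) (f n i j)

δ : ℕ → ℕ → ℤ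
δ m n = if m ℕ.≡ᵇ n then 1ℤ else 0ℤ

mono : ℕ → ℕ → ℕ → Series
mono a b c n i j = δ a n * δ b i * δ c j

shift₁ : ℕ → ℕ → (ℕ → ℤ) → ℤ
shift₁ zero    n       f = f n
shift₁ (suc a) zero    f = 0ℤ
shift₁ (suc a) (suc n) f = shift₁ a n f

shift : ℕ → ℕ → ℕ → Series → Series
shift a b c s n i j = shift₁ a n λ n′ → shift₁ b i λ i′ → shift₁ c j λ j′ → s n′ i′ j′

shift₁-cong : ∀ a n {f g : ℕ → ℤ} → (∀ x → f x ≡ g x) → shift₁ a n f ≡ shift₁ a n g
shift₁-cong zero    n       e = e n
shift₁-cong (suc a) zero    e = refl
shift₁-cong (suc a) (suc n) e = shift₁-cong a n e

shift₁-zero : ∀ a n → shift₁ a n (λ _ → 0ℤ) ≡ 0ℤ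
shift₁-zero zero    n       = refl
shift₁-zero (suc a) zero    = refl
shift₁-zero (suc a) (suc n) = shift₁-zero a n

shift₁-+ : ∀ a n (f g : ℕ → ℤ) → shift₁ a n (λ x → f x + g x) ≡ shift₁ a n f + shift₁ a n g
shift₁-+ zero    n       f g = refl
shift₁-+ (suc a) zero    f g = refl
shift₁-+ (suc a) (suc n) f g = shift₁-+ a n f g

shift₁-- : ∀ a n (f g : ℕ → ℤ) → shift₁ a n (λ x → f x - g x) ≡ shift₁ a n f - shift₁ a n g
shift₁-- zero    n       f g = refl
shift₁-- (suc a) zero    f g = refl
shift₁-- (suc a) (suc n) f g = shift₁-- a n f g

shift₁-*ˡ : ∀ a n c (f : ℕ → ℤ) → shift₁ a n (λ x → c * f x) ≡ c * shift₁ a n f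
shift₁-*ˡ zero    n       c f = refl
shift₁-*ˡ (suc a) zero    c f = sym (ℤP.*-zeroʳ c)
shift₁-*ˡ (suc a) (suc n) c f = shift₁-*ˡ a n c f

shift₁-*ʳ : ∀ a n c (f : ℕ → ℤ) → shift₁ a n (λ x → f x * c) ≡ shift₁ a n f * c
shift₁-*ʳ zero    n       c f = refl
shift₁-*ʳ (suc a) zero    c f = refl
shift₁-*ʳ (suc a) (suc n) c f = shift₁-*ʳ a n c f

shift₁-shift₁ : ∀ a b n (f : ℕ → ℤ) → shift₁ a n (λ x → shift₁ b x f) ≡ shift₁ (a ℕ.+ b) n f
shift₁-shift₁ zero    b n       f = refl
shift₁-shift₁ (suc a) b zero    f = refl
shift₁-shift₁ (suc a) b (suc n) f = shift₁-shift₁ a b n f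

shift₁-comm : ∀ a n b m (f : ℕ → ℕ → ℤ) →
  shift₁ a n (λ x → shift₁ b m (f x)) ≡ shift₁ b m (λ y → shift₁ a n (λ x → f x y))
shift₁-comm zero    n       b m f = refl
shift₁-comm (suc a) zero    b m f = sym (shift₁-zero b m)
shift₁-comm (suc a) (suc n) b m f = shift₁-comm a n b m f

shift₁-δ : ∀ a c n → shift₁ a n (δ c) ≡ δ (a ℕ.+ c) n
shift₁-δ zero    c n       = refl
shift₁-δ (suc a) c zero    = refl
shift₁-δ (suc a) c (suc n) = shift₁-δ a c n

shift₁-const : ∀ a n (f : ℕ → ℤ) → shift₁ a n (λ _ → f (n ∸ a)) ≡ shift₁ a n f
shift₁-const zero    n       f = refl
shift₁-const (suc a) zero    f = refl
shift₁-const (suc a) (suc n) f = shift₁-const a n f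

shift-cong : ∀ a b c {s t} → s ≈ t → shift a b c s ≈ shift a b c t
shift-cong a b c e n i j =
  shift₁-cong a n λ n′ → shift₁-cong b i λ i′ → shift₁-cong c j λ j′ → e n′ i′ j′

shift-⊕ : ∀ a b c s t → shift a b c (s ⊕ t) ≈ shift a b c s ⊕ shift a b c t
shift-⊕ a b c s t n i j =
  trans (shift₁-cong a n λ n′ → trans (shift₁-cong b i λ i′ → shift₁-+ c j _ _) (shift₁-+ b i _ _))
        (shift₁-+ a n _ _)

shift-⊖ : ∀ a b c s t → shift a b c (s ⊖ t) ≈ shift a b c s ⊖ shift a b c t
shift-⊖ a b c s t n i j =
  trans (shift₁-cong a n λ n′ → trans (shift₁-cong b i λ i′ → shift₁-- c j _ _) (shift₁-- b i _ _))
        (shift₁-- a n _ _)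

shift-vanishes : ∀ a b c {s} → (∀ n i j → s n i j ≡ 0ℤ) → ∀ n i j → shift a b c s n i j ≡ 0ℤ
shift-vanishes a b c e n i j =
  trans (shift₁-cong a n λ n′ → trans (shift₁-cong b i λ i′ →
           trans (shift₁-cong c j (e n′ i′)) (shift₁-zero c j)) (shift₁-zero b i))
        (shift₁-zero a n)

shift-shift : ∀ a b c a′ b′ c′ s →
  shift a b c (shift a′ b′ c′ s) ≈ shift (a ℕ.+ a′) (b ℕ.+ b′) (c ℕ.+ c′) s
shift-shift a b c a′ b′ c′ s n i j =
  trans (shift₁-cong a n λ n′ →
           trans (shift₁-cong b i λ i′ → shift₁-comm c j a′ n′ _) (shift₁-comm b i a′ n′ _))
  (trans (shift₁-shift₁ a a′ n _)
         (shift₁-cong (a ℕ.+ a′) n λ n″ →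
            trans (shift₁-cong b i λ i′ → shift₁-comm c j b′ i′ _)
            (trans (shift₁-shift₁ b b′ i _)
                   (shift₁-cong (b ℕ.+ b′) i λ i″ → shift₁-shift₁ c c′ j _))))

shift₂-δ : ∀ b c b′ c′ i j (k : ℤ) →
  shift₁ b i (λ i′ → shift₁ c j λ j′ → k * δ b′ i′ * δ c′ j′) ≡ k * δ (b ℕ.+ b′) i * δ (c ℕ.+ c′) j
shift₂-δ b c b′ c′ i j k = begin
  shift₁ b i (λ i′ → shift₁ c j λ j′ → k * δ b′ i′ * δ c′ j′)
    ≡⟨ shift₁-cong b i (λ i′ → trans (shift₁-*ˡ c j (k * δ b′ i′) (δ c′))
                                     (cong (k * δ b′ i′ *_) (shift₁-δ c c′ j))) ⟩
  shift₁ b i (λ i′ → k * δ b′ i′ * δ (c ℕ.+ c′) j)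
    ≡⟨ shift₁-*ʳ b i _ (λ i′ → k * δ b′ i′) ⟩
  shift₁ b i (λ i′ → k * δ b′ i′) * δ (c ℕ.+ c′) j
    ≡⟨ cong (_* δ (c ℕ.+ c′) j) (trans (shift₁-*ˡ b i k (δ b′)) (cong (k *_) (shift₁-δ b b′ i))) ⟩
  k * δ (b ℕ.+ b′) i * δ (c ℕ.+ c′) j ∎

shift-mono : ∀ a b c a′ b′ c′ → shift a b c (mono a′ b′ c′) ≈ mono (a ℕ.+ a′) (b ℕ.+ b′) (c ℕ.+ c′)
shift-mono a b c a′ b′ c′ n i j = begin
  shift₁ a n (λ n′ → shift₁ b i λ i′ → shift₁ c j λ j′ → δ a′ n′ * δ b′ i′ * δ c′ j′)
    ≡⟨ shift₁-cong a n (λ n′ → shift₂-δ b c b′ c′ i j (δ a′ n′)) ⟩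
  shift₁ a n (λ n′ → δ a′ n′ * δ (b ℕ.+ b′) i * δ (c ℕ.+ c′) j)
    ≡⟨ shift₁-*ʳ a n (δ (c ℕ.+ c′) j) (λ n′ → δ a′ n′ * δ (b ℕ.+ b′) i) ⟩
  shift₁ a n (λ n′ → δ a′ n′ * δ (b ℕ.+ b′) i) * δ (c ℕ.+ c′) j
    ≡⟨ cong (_* δ (c ℕ.+ c′) j) (trans (shift₁-*ʳ a n (δ (b ℕ.+ b′) i) (δ a′))
                                       (cong (_* δ (b ℕ.+ b′) i) (shift₁-δ a a′ n))) ⟩
  mono (a ℕ.+ a′) (b ℕ.+ b′) (c ℕ.+ c′) n i j ∎

shift-at : ∀ {a a′ b b′ c c′} s n i j → a ≡ a′ → b ≡ b′ → c ≡ c′ → shift a b c s n i j ≡ shift a′ b′ c′ s n i j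
shift-at s n i j refl refl refl = refl

mono-at : ∀ {a a′ b b′ c c′} → a ≡ a′ → b ≡ b′ → c ≡ c′ → mono a b c ≈ mono a′ b′ c′
mono-at refl refl refl n i j = refl

sumTo-cong : ∀ m {f g : ℕ → ℤ} → (∀ x → f x ≡ g x) → sumTo m f ≡ sumTo m g
sumTo-cong zero    e = e 0
sumTo-cong (suc m) e = cong₂ _+_ (sumTo-cong m e) (e (suc m))

sumTo-+ : ∀ m (f g : ℕ → ℤ) → sumTo m (λ x → f x + g x) ≡ sumTo m f + sumTo m g
sumTo-+ zero    f g = refl
sumTo-+ (suc m) f g =
  trans (cong (_+ (f (suc m) + g (suc m))) (sumTo-+ m f g))
        (interchange (sumTo m f) (sumTo m g) (f (suc m)) (g (suc m)))
  where interchange : ∀ a b c d → a + b + (c + d) ≡ a + c + (b + d)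
        interchange = solve-∀

sumTo-- : ∀ m (f g : ℕ → ℤ) → sumTo m (λ x → f x - g x) ≡ sumTo m f - sumTo m g
sumTo-- zero    f g = refl
sumTo-- (suc m) f g =
  trans (cong (_+ (f (suc m) - g (suc m))) (sumTo-- m f g))
        (interchange (sumTo m f) (sumTo m g) (f (suc m)) (g (suc m)))
  where interchange : ∀ a b c d → a - b + (c - d) ≡ a + c - (b + d)
        interchange = solve-∀

sumTo-*ˡ : ∀ m c (f : ℕ → ℤ) → sumTo m (λ x → c * f x) ≡ c * sumTo m f
sumTo-*ˡ zero    c f = refl
sumTo-*ˡ (suc m) c f =
  trans (cong (_+ c * f (suc m)) (sumTo-*ˡ m c f)) (sym (ℤP.*-distribˡ-+ c _ _))

sumTo-δ-const : ∀ a m (v : ℕ → ℤ) → sumTo m (λ x → δ a x * v x) ≡ shift₁ a m (λ _ → v a)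
sumTo-δ-const zero    zero    v = ℤP.*-identityˡ (v 0)
sumTo-δ-const (suc a) zero    v = refl
sumTo-δ-const zero    (suc m) v = trans (cong (_+ 0ℤ) (sumTo-δ-const zero m v)) (ℤP.+-identityʳ (v 0))
sumTo-δ-const (suc a) (suc m) v = trans (sumTo-δ-suc m) (sumTo-δ-const a m (λ x → v (suc x)))
  where
  sumTo-δ-suc : ∀ m → sumTo (suc m) (λ x → δ (suc a) x * v x) ≡ sumTo m (λ x → δ a x * v (suc x))
  sumTo-δ-suc zero    = ℤP.+-identityˡ _
  sumTo-δ-suc (suc m) = cong (_+ δ a (suc m) * v (suc (suc m))) (sumTo-δ-suc m)

sumTo-δ : ∀ a m (f : ℕ → ℤ) → sumTo m (λ x → δ a x * f (m ∸ x)) ≡ shift₁ a m f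
sumTo-δ a m f = trans (sumTo-δ-const a m (λ x → f (m ∸ x))) (shift₁-const a m f)

⊛-cong : ∀ {s s′ t t′} → s ≈ s′ → t ≈ t′ → s ⊛ t ≈ s′ ⊛ t′
⊛-cong e f n i j = sumTo-cong n λ a → sumTo-cong i λ b → sumTo-cong j λ c →
  cong₂ _*_ (e a b c) (f (n ∸ a) (i ∸ b) (j ∸ c))

⊛-distribʳ-⊕ : ∀ s t u → (s ⊕ t) ⊛ u ≈ s ⊛ u ⊕ t ⊛ u
⊛-distribʳ-⊕ s t u n i j =
  trans (sumTo-cong n λ a → trans (sumTo-cong i λ b →
           trans (sumTo-cong j λ c → ℤP.*-distribʳ-+ (u (n ∸ a) (i ∸ b) (j ∸ c)) (s a b c) (t a b c))
                 (sumTo-+ j _ _))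
           (sumTo-+ i _ _))
        (sumTo-+ n _ _)

⊛-distribʳ-⊖ : ∀ s t u → (s ⊖ t) ⊛ u ≈ s ⊛ u ⊖ t ⊛ u
⊛-distribʳ-⊖ s t u n i j =
  trans (sumTo-cong n λ a → trans (sumTo-cong i λ b →
           trans (sumTo-cong j λ c → distribʳ (u (n ∸ a) (i ∸ b) (j ∸ c)) (s a b c) (t a b c))
                 (sumTo-- j _ _))
           (sumTo-- i _ _))
        (sumTo-- n _ _)
  where distribʳ : ∀ x y z → (y - z) * x ≡ y * x - z * x
        distribʳ = solve-∀

mono-⊛ : ∀ a b c t → mono a b c ⊛ t ≈ shift a b c t
mono-⊛ a b c t n i j = begin
  sumTo n (λ a′ → sumTo i λ b′ → sumTo j λ c′ → δ a a′ * δ b b′ * δ c c′ * t (n ∸ a′) (i ∸ b′) (j ∸ c′))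
    ≡⟨ sumTo-cong n (λ a′ → sumTo-cong i λ b′ → trans
         (sumTo-cong j λ c′ → ℤP.*-assoc (δ a a′ * δ b b′) (δ c c′) _)
         (trans (sumTo-*ˡ j (δ a a′ * δ b b′) (λ c′ → δ c c′ * t (n ∸ a′) (i ∸ b′) (j ∸ c′)))
                (cong (δ a a′ * δ b b′ *_) (sumTo-δ c j _)))) ⟩
  sumTo n (λ a′ → sumTo i λ b′ → δ a a′ * δ b b′ * shift₁ c j (t (n ∸ a′) (i ∸ b′)))
    ≡⟨ sumTo-cong n (λ a′ → trans
         (sumTo-cong i λ b′ → ℤP.*-assoc (δ a a′) (δ b b′) _)
         (trans (sumTo-*ˡ i (δ a a′) (λ b′ → δ b b′ * shift₁ c j (t (n ∸ a′) (i ∸ b′))))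
                (cong (δ a a′ *_) (sumTo-δ b i _)))) ⟩
  sumTo n (λ a′ → δ a a′ * shift₁ b i λ i′ → shift₁ c j (t (n ∸ a′) i′))
    ≡⟨ sumTo-δ a n _ ⟩
  shift a b c t n i j ∎

-- a record, so that the exponents can be inferred from the type
record IsMonomial (s : Series) (a b c : ℕ) : Set where
  constructor monomial
  field ≈mono : s ≈ mono a b c
open IsMonomial

reindex : ∀ {s a a′ b b′ c c′} → IsMonomial s a b c → a ≡ a′ → b ≡ b′ → c ≡ c′ → IsMonomial s a′ b′ c′
reindex m refl refl refl = m

isZero≡δ0 : ∀ n → isZero n ≡ δ 0 n
isZero≡δ0 zero    = refl
isZero≡δ0 (suc n) = refl

isZero-isZero≡δ1 : ∀ n → isZero (n ∸ 1) * isZero (1 ∸ n) ≡ δ 1 n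
isZero-isZero≡δ1 zero          = refl
isZero-isZero≡δ1 (suc zero)    = refl
isZero-isZero≡δ1 (suc (suc n)) = refl

𝟙-monomial : IsMonomial 𝟙 0 0 0
𝟙-monomial = monomial (λ n i j → cong₂ _*_ (cong₂ _*_ (isZero≡δ0 n) (isZero≡δ0 i)) (isZero≡δ0 j))

X-monomial : IsMonomial X 1 0 0
X-monomial = monomial (λ n i j → cong₂ _*_ (cong₂ _*_ (isZero-isZero≡δ1 n) (isZero≡δ0 i)) (isZero≡δ0 j))

P-monomial : IsMonomial P 0 1 0
P-monomial = monomial (λ n i j →
  trans (cong (_* isZero j) (ℤP.*-assoc (isZero n) _ _))
        (cong₂ _*_ (cong₂ _*_ (isZero≡δ0 n) (isZero-isZero≡δ1 i)) (isZero≡δ0 j)))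

Q-monomial : IsMonomial Q 0 0 1
Q-monomial = monomial (λ n i j →
  trans (ℤP.*-assoc (isZero n * isZero i) _ _)
        (cong₂ _*_ (cong₂ _*_ (isZero≡δ0 n) (isZero≡δ0 i)) (isZero-isZero≡δ1 j)))

⊛-monomial : ∀ {s t a b c a′ b′ c′} → IsMonomial s a b c → IsMonomial t a′ b′ c′ →
  IsMonomial (s ⊛ t) (a ℕ.+ a′) (b ℕ.+ b′) (c ℕ.+ c′)
⊛-monomial {a = a} {b} {c} {a′} {b′} {c′} (monomial s≈) (monomial t≈) = monomial
  (≈-trans (⊛-cong s≈ t≈) (≈-trans (mono-⊛ a b c (mono a′ b′ c′)) (shift-mono a b c a′ b′ c′)))

P^^-monomial : ∀ m → IsMonomial (P ^^ m) 0 m 0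
P^^-monomial zero    = 𝟙-monomial
P^^-monomial (suc m) = ⊛-monomial P-monomial (P^^-monomial m)

Q^^-monomial : ∀ m → IsMonomial (Q ^^ m) 0 0 m
Q^^-monomial zero    = 𝟙-monomial
Q^^-monomial (suc m) = ⊛-monomial Q-monomial (Q^^-monomial m)

X^^-monomial : ∀ m → IsMonomial (X ^^ m) m 0 0
X^^-monomial zero    = 𝟙-monomial
X^^-monomial (suc m) = ⊛-monomial X-monomial (X^^-monomial m)

PQX-monomial : ∀ a b c → IsMonomial (P ^^ b ⊛ Q ^^ c ⊛ X ^^ a) a b c
PQX-monomial a b c =
  reindex (⊛-monomial (⊛-monomial (P^^-monomial b) (Q^^-monomial c)) (X^^-monomial a))
          refl (trans (ℕP.+-identityʳ (b ℕ.+ 0)) (ℕP.+-identityʳ b)) (ℕP.+-identityʳ c)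

infixl 6 _⊞_ _⊟_

-- signed sums of monomials, as syntax so that products with them can be computed term by term
data Poly : Set where
  mon     : ℕ → ℕ → ℕ → Poly
  _⊞_ _⊟_ : Poly → Poly → Poly

⟦_⟧ : Poly → Series
⟦ mon a b c ⟧ = mono a b c
⟦ p ⊞ q ⟧     = ⟦ p ⟧ ⊕ ⟦ q ⟧
⟦ p ⊟ q ⟧     = ⟦ p ⟧ ⊖ ⟦ q ⟧

_·_ : Poly → Series → Series
mon a b c · f = shift a b c f
(p ⊞ q)   · f = p · f ⊕ q · f
(p ⊟ q)   · f = p · f ⊖ q · f

⟦⟧-⊛ : ∀ p f → ⟦ p ⟧ ⊛ f ≈ p · f
⟦⟧-⊛ (mon a b c) f = mono-⊛ a b c f
⟦⟧-⊛ (p ⊞ q)     f = ≈-trans (⊛-distribʳ-⊕ ⟦ p ⟧ ⟦ q ⟧ f) (⊕-cong (⟦⟧-⊛ p f) (⟦⟧-⊛ q f))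
⟦⟧-⊛ (p ⊟ q)     f = ≈-trans (⊛-distribʳ-⊖ ⟦ p ⟧ ⟦ q ⟧ f) (⊖-cong (⟦⟧-⊛ p f) (⟦⟧-⊛ q f))

shiftPoly : ℕ → ℕ → ℕ → Poly → Poly
shiftPoly a b c (mon a′ b′ c′) = mon (a ℕ.+ a′) (b ℕ.+ b′) (c ℕ.+ c′)
shiftPoly a b c (p ⊞ q)        = shiftPoly a b c p ⊞ shiftPoly a b c q
shiftPoly a b c (p ⊟ q)        = shiftPoly a b c p ⊟ shiftPoly a b c q

shift-⟦⟧ : ∀ a b c p → shift a b c ⟦ p ⟧ ≈ ⟦ shiftPoly a b c p ⟧
shift-⟦⟧ a b c (mon a′ b′ c′) = shift-mono a b c a′ b′ c′
shift-⟦⟧ a b c (p ⊞ q) =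
  ≈-trans (shift-⊕ a b c ⟦ p ⟧ ⟦ q ⟧) (⊕-cong (shift-⟦⟧ a b c p) (shift-⟦⟧ a b c q))
shift-⟦⟧ a b c (p ⊟ q) =
  ≈-trans (shift-⊖ a b c ⟦ p ⟧ ⟦ q ⟧) (⊖-cong (shift-⟦⟧ a b c p) (shift-⟦⟧ a b c q))

DenPoly : ℕ → Poly
DenPoly k = mon 0 0 0 ⊟ (mon 1 1 1 ⊞ mon 1 1 2) ⊞ (mon 2 2 3 ⊟ mon 2 3 3)
          ⊞ mon (k ℕ.+ 1) (k ℕ.+ 2) (2 ℕ.* k ℕ.+ 1)

NumPoly : ℕ → Poly
NumPoly k = mon 1 2 1 ⊞ mon 1 3 2 ⊟ (mon 2 3 3 ⊟ mon 2 4 3)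
          ⊟ mon k (2 ℕ.+ k) (2 ℕ.* k) ⊟ mon (k ℕ.+ 1) (2 ℕ.+ (k ℕ.+ 1)) (2 ℕ.* k ℕ.+ 1)

Den-⊛ : ∀ k f → Den k ⊛ f ≈ DenPoly k · f
Den-⊛ k f = ≈-trans (⊛-cong {t = f} {t′ = f} Den≈ ≈-refl) (⟦⟧-⊛ (DenPoly k) f)
  where
  Den≈ : Den k ≈ ⟦ DenPoly k ⟧
  Den≈ =
    ⊕-cong (⊕-cong (⊖-cong (≈mono 𝟙-monomial)
                     (≈-trans (⊛-distribʳ-⊕ (P ⊛ Q) (P ⊛ Q ^^ 2) X)
                              (⊕-cong (≈mono (⊛-monomial (⊛-monomial P-monomial Q-monomial) X-monomial))
                                      (≈mono (⊛-monomial (⊛-monomial P-monomial (Q^^-monomial 2)) X-monomial)))))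
                   (≈-trans (⊛-distribʳ-⊖ (P ^^ 2 ⊛ Q ^^ 3) (P ^^ 3 ⊛ Q ^^ 3) (X ^^ 2))
                            (⊖-cong (≈mono (PQX-monomial 2 2 3)) (≈mono (PQX-monomial 2 3 3)))))
           (≈mono (PQX-monomial (k ℕ.+ 1) (k ℕ.+ 2) (2 ℕ.* k ℕ.+ 1)))

Num≈ : ∀ k → Num k ≈ ⟦ NumPoly k ⟧
Num≈ k = ≈-trans (⊛-cong (≈mono (P^^-monomial 2)) factor≈)
                 (≈-trans (mono-⊛ 0 2 0 ⟦ factor ⟧) (shift-⟦⟧ 0 2 0 factor))
  where
  factor : Poly
  factor = mon 1 0 1 ⊞ mon 1 1 2 ⊟ (mon 2 1 3 ⊟ mon 2 2 3)
         ⊟ mon k k (2 ℕ.* k) ⊟ mon (k ℕ.+ 1) (k ℕ.+ 1) (2 ℕ.* k ℕ.+ 1)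
  factor≈ : (Q ⊕ P ⊛ Q ^^ 2) ⊛ X ⊖ (P ⊛ Q ^^ 3 ⊖ P ^^ 2 ⊛ Q ^^ 3) ⊛ X ^^ 2
            ⊖ P ^^ k ⊛ Q ^^ (2 ℕ.* k) ⊛ X ^^ k
            ⊖ P ^^ (k ℕ.+ 1) ⊛ Q ^^ (2 ℕ.* k ℕ.+ 1) ⊛ X ^^ (k ℕ.+ 1)
          ≈ ⟦ factor ⟧
  factor≈ =
    ⊖-cong (⊖-cong (⊖-cong
      (≈-trans (⊛-distribʳ-⊕ Q (P ⊛ Q ^^ 2) X)
               (⊕-cong (≈mono (⊛-monomial Q-monomial X-monomial))
                       (≈mono (⊛-monomial (⊛-monomial P-monomial (Q^^-monomial 2)) X-monomial))))
      (≈-trans (⊛-distribʳ-⊖ (P ⊛ Q ^^ 3) (P ^^ 2 ⊛ Q ^^ 3) (X ^^ 2))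
               (⊖-cong (≈mono (⊛-monomial (⊛-monomial P-monomial (Q^^-monomial 3)) (X^^-monomial 2)))
                       (≈mono (PQX-monomial 2 2 3)))))
      (≈mono (PQX-monomial k k (2 ℕ.* k))))
      (≈mono (PQX-monomial (k ℕ.+ 1) (k ℕ.+ 1) (2 ℕ.* k ℕ.+ 1)))

ones : ℕ → List Bool
ones r = replicate r true

ones-++-true : ∀ r w → ones r ++ true ∷ w ≡ ones (suc r) ++ w
ones-++-true zero    w = refl
ones-++-true (suc r) w = cong (true ∷_) (ones-++-true r w)

prefix-ones-false : ∀ {k r w} → Prefix _≡_ (ones k) (ones r ++ false ∷ w) → k ≤ r
prefix-ones-false {zero}          _       = z≤n
prefix-ones-false {suc k} {zero}  (() ∷ _)
prefix-ones-false {suc k} {suc r} (_ ∷ p) = s≤s (prefix-ones-false p)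

infix-ones-false : ∀ {k r w} → Infix _≡_ (ones (suc k)) (ones r ++ false ∷ w) →
                   suc k ≤ r ⊎ Infix _≡_ (ones (suc k)) w
infix-ones-false {r = zero}  (here p)  = inj₁ (prefix-ones-false p)
infix-ones-false {r = zero}  (there q) = inj₂ q
infix-ones-false {r = suc r} (here p)  = inj₁ (prefix-ones-false p)
infix-ones-false {r = suc r} (there q) = map₁ ℕP.m≤n⇒m≤1+n (infix-ones-false q)

ones-false-kBonacci⁻ : ∀ {k} r w → IsKBonacci k (ones r ++ false ∷ w) → IsKBonacci k w
ones-false-kBonacci⁻ r w avoids inside = avoids (ones r ++ⁱ there inside)

ones-false-kBonacci⁺ : ∀ {k r} w → r < k → IsKBonacci k w → IsKBonacci k (ones r ++ false ∷ w)
ones-false-kBonacci⁺ {suc k} w r<k avoids inside = [ ℕP.<⇒≱ r<k , avoids ]′ (infix-ones-false inside)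

ones-kBonacci : ∀ {k r} → r < k → IsKBonacci k (ones r ++ [])
ones-kBonacci {k} {r} r<k inside = ℕP.<⇒≱ r<k
  (subst₂ _≤_ (length-replicate k) (length-replicate r)
          (length-mono (subst (Infix _≡_ (ones k)) (++-identityʳ (ones r)) inside)))

ones-not-kBonacci : ∀ {k r} w → k ≤ r → ¬ IsKBonacci k (ones r ++ w)
ones-not-kBonacci w k≤r avoids = avoids (here (Prefix.replicate⁺ k≤r refl ++ᵖ w))

indicator : ∀ {A : Set} → Dec A → ℤ
indicator a? = if does a? then 1ℤ else 0ℤ

indicator-cong : ∀ {A B : Set} → (A → B) → (B → A) →
                 (a? : Dec A) (b? : Dec B) → indicator a? ≡ indicator b?
indicator-cong f g (yes a) (yes b) = refl
indicator-cong f g (yes a) (no ¬b) = ⊥-elim (¬b (f a))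
indicator-cong f g (no ¬a) (yes b) = ⊥-elim (¬a (g b))
indicator-cong f g (no ¬a) (no ¬b) = refl

indicator-yes : ∀ {A : Set} → A → (a? : Dec A) → indicator a? ≡ 1ℤ
indicator-yes a (yes _) = refl
indicator-yes a (no ¬a) = ⊥-elim (¬a a)

indicator-no : ∀ {A : Set} → ¬ A → (a? : Dec A) → indicator a? ≡ 0ℤ
indicator-no ¬a (yes a) = ⊥-elim (¬a a)
indicator-no ¬a (no _)  = refl

indicator-× : ∀ {A B : Set} (a? : Dec A) (b? : Dec B) →
              indicator (a? ×-dec b?) ≡ indicator a? * indicator b?
indicator-× (yes _) (yes _) = refl
indicator-× (yes _) (no _)  = refl
indicator-× (no _)  (yes _) = refl
indicator-× (no _)  (no _)  = refl

-- the number of steps 0 → 1 in b ∷ w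
rises : Bool → List Bool → ℕ
rises b []          = 0
rises b (false ∷ w) = rises false w
rises b (true ∷ w)  = bit (not b) ℕ.+ rises true w

-- exposed vertical edges come in equal numbers on the way up and on the way down
vertEdges-rises : ∀ b w → vertEdges (suc (bit b)) (heights w) ≡ suc (bit b) ℕ.+ 2 ℕ.* rises b w
vertEdges-rises false []          = refl
vertEdges-rises true  []          = refl
vertEdges-rises false (false ∷ w) = vertEdges-rises false w
vertEdges-rises true  (false ∷ w) = cong suc (vertEdges-rises false w)
vertEdges-rises false (true ∷ w)  =
  cong suc (trans (vertEdges-rises true w) (sym (ℕP.*-suc 2 (rises true w))))
vertEdges-rises true  (true ∷ w)  = vertEdges-rises true w

-- the contribution of w to the semiperimeter when w follows r ones
sperAfter : ℕ → List Bool → ℕ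
sperAfter r w = suc (length w) ℕ.+ rises (0 <ᵇ r) w

sper-cons : ∀ b w → sper (b ∷ w) ≡ sperAfter 0 (b ∷ w)
sper-cons b w = trans (cong ⌊_/2⌋ (perimeter-cons b)) (sym (ℕP.n≡⌊n+n/2⌋ (sperAfter 0 (b ∷ w))))
  where
  L = length w
  halves : ∀ b → perimeter (b ∷ w)
                 ≡ (suc (suc L) ℕ.+ (bit b ℕ.+ rises b w)) ℕ.+ (suc (suc L) ℕ.+ (bit b ℕ.+ rises b w))
  halves b = trans (cong (λ v → 2 ℕ.* suc L ℕ.+ (suc (bit b) ℕ.+ 0 ℕ.+ v)) (vertEdges-rises b w))
                   (arithmetic L (bit b) (rises b w))
    where
    arithmetic : ∀ l c r → 2 ℕ.* suc l ℕ.+ (suc c ℕ.+ 0 ℕ.+ (suc c ℕ.+ 2 ℕ.* r))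
                         ≡ (suc (suc l) ℕ.+ (c ℕ.+ r)) ℕ.+ (suc (suc l) ℕ.+ (c ℕ.+ r))
    arithmetic = ℕSolver.solve-∀
  perimeter-cons : ∀ b → perimeter (b ∷ w) ≡ sperAfter 0 (b ∷ w) ℕ.+ sperAfter 0 (b ∷ w)
  perimeter-cons false = halves false
  perimeter-cons true  = halves true

sumOver : ∀ {A : Set} → (A → ℤ) → List A → ℤ
sumOver f []       = 0ℤ
sumOver f (x ∷ xs) = f x + sumOver f xs

sumOver-cong : ∀ {A : Set} {f g : A → ℤ} xs → (∀ x → f x ≡ g x) → sumOver f xs ≡ sumOver g xs
sumOver-cong []       e = refl
sumOver-cong (x ∷ xs) e = cong₂ _+_ (e x) (sumOver-cong xs e)

sumOver-++ : ∀ {A : Set} (f : A → ℤ) xs ys → sumOver f (xs ++ ys) ≡ sumOver f xs + sumOver f ys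
sumOver-++ f []       ys = sym (ℤP.+-identityˡ _)
sumOver-++ f (x ∷ xs) ys = trans (cong (f x +_) (sumOver-++ f xs ys)) (sym (ℤP.+-assoc (f x) _ _))

sumOver-map : ∀ {A B : Set} (f : B → ℤ) (h : A → B) xs → sumOver f (map h xs) ≡ sumOver (λ x → f (h x)) xs
sumOver-map f h []       = refl
sumOver-map f h (x ∷ xs) = cong (f (h x) +_) (sumOver-map f h xs)

sumOver-zero : ∀ {A : Set} (xs : List A) → sumOver (λ _ → 0ℤ) xs ≡ 0ℤ
sumOver-zero []       = refl
sumOver-zero (x ∷ xs) = cong (0ℤ +_) (sumOver-zero xs)

sumOver-shift₁ : ∀ {A : Set} a i (f : A → ℕ → ℤ) xs →
  sumOver (λ x → shift₁ a i (f x)) xs ≡ shift₁ a i (λ i′ → sumOver (λ x → f x i′) xs)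
sumOver-shift₁ a i f []       = sym (shift₁-zero a i)
sumOver-shift₁ a i f (x ∷ xs) =
  trans (cong (shift₁ a i (f x) +_) (sumOver-shift₁ a i f xs)) (sym (shift₁-+ a i (f x) _))

sumOver-shift₂ : ∀ {A : Set} b c i j (f : A → ℕ → ℕ → ℤ) xs →
  sumOver (λ x → shift₁ b i λ i′ → shift₁ c j (f x i′)) xs
    ≡ shift₁ b i (λ i′ → shift₁ c j λ j′ → sumOver (λ x → f x i′ j′) xs)
sumOver-shift₂ b c i j f xs =
  trans (sumOver-shift₁ b i (λ x i′ → shift₁ c j (f x i′)) xs)
        (shift₁-cong b i λ i′ → sumOver-shift₁ c j (λ x → f x i′) xs)

sumOver-allWords : ∀ (f : List Bool → ℤ) n →
  sumOver f (allWords (suc n))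
    ≡ sumOver (λ w → f (false ∷ w)) (allWords n) + sumOver (λ w → f (true ∷ w)) (allWords n)
sumOver-allWords f n =
  trans (sumOver-++ f (map (false ∷_) (allWords n)) (map (true ∷_) (allWords n)))
        (cong₂ _+_ (sumOver-map f (false ∷_) (allWords n)) (sumOver-map f (true ∷_) (allWords n)))

length-filter : ∀ {A : Set} {Q : A → Set} (Q? : ∀ x → Dec (Q x)) xs →
  ℤ.+ length (filter Q? xs) ≡ sumOver (λ x → indicator (Q? x)) xs
length-filter Q? []       = refl
length-filter Q? (x ∷ xs) with does (Q? x)
... | true  = cong (1ℤ +_) (length-filter Q? xs)
... | false = trans (length-filter Q? xs) (sym (ℤP.+-identityˡ _))

weight : ℕ → ℕ → List Bool → ℕ → ℕ → ℤ
weight k r w i j = indicator (isKBonacci? k (ones r ++ w)) * δ (sperAfter r w) i * δ (area w) j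

G : ℕ → ℕ → Series
G k r n i j = sumOver (λ w → weight k r w i j) (allWords n)

sperIncrement : ℕ → ℕ
sperIncrement zero    = 2
sperIncrement (suc r) = 1

sperAfter-true : ∀ r w → sperAfter r (true ∷ w) ≡ sperIncrement r ℕ.+ sperAfter (suc r) w
sperAfter-true zero    w = cong suc (ℕP.+-suc (suc (length w)) (rises true w))
sperAfter-true (suc r) w = refl

weight-false : ∀ {k r} w i j → r < k →
  weight k r (false ∷ w) i j ≡ shift₁ 1 i (λ i′ → shift₁ 1 j (weight k 0 w i′))
weight-false {k} {r} w i j r<k = begin
  indicator (isKBonacci? k (ones r ++ false ∷ w)) * δ (suc (sperAfter 0 w)) i * δ (suc (area w)) j
    ≡⟨ cong (λ c → c * δ (suc (sperAfter 0 w)) i * δ (suc (area w)) j)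
            (indicator-cong (ones-false-kBonacci⁻ r w) (ones-false-kBonacci⁺ w r<k)
                            (isKBonacci? k (ones r ++ false ∷ w)) (isKBonacci? k w)) ⟩
  indicator (isKBonacci? k w) * δ (suc (sperAfter 0 w)) i * δ (suc (area w)) j
    ≡⟨ sym (shift₂-δ 1 1 (sperAfter 0 w) (area w) i j (indicator (isKBonacci? k w))) ⟩
  shift₁ 1 i (λ i′ → shift₁ 1 j (weight k 0 w i′)) ∎

weight-true : ∀ {k} r w i j →
  weight k r (true ∷ w) i j ≡ shift₁ (sperIncrement r) i (λ i′ → shift₁ 2 j (weight k (suc r) w i′))
weight-true {k} r w i j = begin
  indicator (isKBonacci? k (ones r ++ true ∷ w)) * δ (sperAfter r (true ∷ w)) i * δ (2 ℕ.+ area w) j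
    ≡⟨ cong₂ (λ v s → indicator (isKBonacci? k v) * δ s i * δ (2 ℕ.+ area w) j)
             (ones-++-true r w) (sperAfter-true r w) ⟩
  indicator (isKBonacci? k (ones (suc r) ++ w)) * δ (sperIncrement r ℕ.+ sperAfter (suc r) w) i
    * δ (2 ℕ.+ area w) j
    ≡⟨ sym (shift₂-δ (sperIncrement r) 2 (sperAfter (suc r) w) (area w) i j
                   (indicator (isKBonacci? k (ones (suc r) ++ w)))) ⟩
  shift₁ (sperIncrement r) i (λ i′ → shift₁ 2 j (weight k (suc r) w i′)) ∎

G-unfold : ∀ {k r} → r < k →
  G k r ≈ mono 0 1 0 ⊕ shift 1 1 1 (G k 0) ⊕ shift 1 (sperIncrement r) 2 (G k (suc r))
G-unfold {k} {r} r<k zero i j =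
  trans (cong (λ c → c * δ 1 i * δ 0 j + 0ℤ)
              (indicator-yes (ones-kBonacci r<k) (isKBonacci? k (ones r ++ []))))
        (cong (_+ 0ℤ) (sym (ℤP.+-identityʳ (mono 0 1 0 0 i j))))
G-unfold {k} {r} r<k (suc n) i j = begin
  sumOver (λ w → weight k r w i j) (allWords (suc n))
    ≡⟨ sumOver-allWords _ n ⟩
  sumOver (λ w → weight k r (false ∷ w) i j) (allWords n)
    + sumOver (λ w → weight k r (true ∷ w) i j) (allWords n)
    ≡⟨ cong₂ _+_
         (trans (sumOver-cong (allWords n) λ w → weight-false w i j r<k)
                (sumOver-shift₂ 1 1 i j (weight k 0) (allWords n)))
         (trans (sumOver-cong (allWords n) λ w → weight-true {k} r w i j)
                (sumOver-shift₂ (sperIncrement r) 2 i j (weight k (suc r)) (allWords n))) ⟩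
  shift 1 1 1 (G k 0) (suc n) i j + shift 1 (sperIncrement r) 2 (G k (suc r)) (suc n) i j
    ≡⟨ cong (_+ shift 1 (sperIncrement r) 2 (G k (suc r)) (suc n) i j)
            (sym (ℤP.+-identityˡ (shift 1 1 1 (G k 0) (suc n) i j))) ⟩
  (mono 0 1 0 ⊕ shift 1 1 1 (G k 0) ⊕ shift 1 (sperIncrement r) 2 (G k (suc r))) (suc n) i j ∎

G-vanishes : ∀ {k r} → k ≤ r → ∀ n i j → G k r n i j ≡ 0ℤ
G-vanishes {k} {r} k≤r n i j =
  trans (sumOver-cong (allWords n) λ w →
           cong (λ c → c * δ (sperAfter r w) i * δ (area w) j)
                (indicator-no (ones-not-kBonacci w k≤r) (isKBonacci? k (ones r ++ w))))
        (sumOver-zero (allWords n))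

count≡G : ∀ k n i j → ℤ.+ count k (suc n) i j ≡ G k 0 (suc n) i j
count≡G k n i j = begin
  ℤ.+ count k (suc n) i j
    ≡⟨ length-filter _ (allWords (suc n)) ⟩
  sumOver (λ w → indicator (word? w)) (allWords (suc n))
    ≡⟨ sumOver-allWords _ n ⟩
  sumOver (λ w → indicator (word? (false ∷ w))) (allWords n)
    + sumOver (λ w → indicator (word? (true ∷ w))) (allWords n)
    ≡⟨ cong₂ _+_ (sumOver-cong (allWords n) (indicator≡weight false))
                 (sumOver-cong (allWords n) (indicator≡weight true)) ⟩
  sumOver (λ w → weight k 0 (false ∷ w) i j) (allWords n)
    + sumOver (λ w → weight k 0 (true ∷ w) i j) (allWords n)
    ≡⟨ sumOver-allWords (λ w → weight k 0 w i j) n ⟨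
  G k 0 (suc n) i j ∎
  where
  word? : ∀ w → Dec (IsKBonacci k w × sper w ≡ i × area w ≡ j)
  word? w = isKBonacci? k w ×-dec (sper w ℕP.≟ i) ×-dec (area w ℕP.≟ j)
  indicator≡weight : ∀ b w → indicator (word? (b ∷ w)) ≡ weight k 0 (b ∷ w) i j
  indicator≡weight b w = begin
    indicator (word? (b ∷ w))
      ≡⟨ trans (indicator-× (isKBonacci? k (b ∷ w)) ((sper (b ∷ w) ℕP.≟ i) ×-dec (area (b ∷ w) ℕP.≟ j)))
               (cong (indicator (isKBonacci? k (b ∷ w)) *_)
                     (indicator-× (sper (b ∷ w) ℕP.≟ i) (area (b ∷ w) ℕP.≟ j))) ⟩
    indicator (isKBonacci? k (b ∷ w)) * (δ (sper (b ∷ w)) i * δ (area (b ∷ w)) j)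
      ≡⟨ sym (ℤP.*-assoc (indicator (isKBonacci? k (b ∷ w))) _ _) ⟩
    indicator (isKBonacci? k (b ∷ w)) * δ (sper (b ∷ w)) i * δ (area (b ∷ w)) j
      ≡⟨ cong (λ s → indicator (isKBonacci? k (b ∷ w)) * δ s i * δ (area (b ∷ w)) j) (sper-cons b w) ⟩
    weight k 0 (b ∷ w) i j ∎

G≈F⊕p : ∀ {k} → 0 < k → G k 0 ≈ F k ⊕ mono 0 1 0
G≈F⊕p {k} 0<k zero i j =
  trans (cong (λ c → c * δ 1 i * δ 0 j + 0ℤ) (indicator-yes (ones-kBonacci 0<k) (isKBonacci? k [])))
        (trans (ℤP.+-identityʳ (mono 0 1 0 0 i j)) (sym (ℤP.+-identityˡ (mono 0 1 0 0 i j))))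
G≈F⊕p {k} 0<k (suc n) i j = trans (sym (count≡G k n i j)) (sym (ℤP.+-identityʳ (F k (suc n) i j)))

+-minus-interchange : ∀ a b c d → (a + b) - (c + d) ≡ (a - c) + (b - d)
+-minus-interchange = solve-∀

U : ℕ → Series
U k = mono 0 1 0 ⊕ shift 1 1 1 (G k 0)

-- multiplication by y^d, where y = x p q²
shiftY : ℕ → Series → Series
shiftY d = shift d d (d ℕ.+ d)

G-telescope : ∀ {k} d r → suc r ℕ.+ d ≡ k →
  G k (suc r) ⊖ shiftY 1 (G k (suc r)) ≈ U k ⊖ shiftY d (U k)
G-telescope {k} zero r eq n i j = begin
  G k (suc r) n i j - shiftY 1 (G k (suc r)) n i j
    ≡⟨ cong₂ _-_ (vanishes n i j) (shift-vanishes 1 1 2 vanishes n i j) ⟩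
  0ℤ
    ≡⟨ sym (ℤP.+-inverseʳ (U k n i j)) ⟩
  U k n i j - U k n i j ∎
  where
  vanishes : ∀ n i j → G k (suc r) n i j ≡ 0ℤ
  vanishes = G-vanishes (ℕP.≤-reflexive (trans (sym eq) (ℕP.+-identityʳ (suc r))))
G-telescope {k} (suc d) r eq n i j = begin
  G k (suc r) n i j - Y (G k (suc r)) n i j
    ≡⟨ cong₂ _-_ (G-unfold r<k n i j)
                 (trans (shift-cong 1 1 2 (G-unfold r<k) n i j) (shift-⊕ 1 1 2 (U k) (Y H) n i j)) ⟩
  (U k n i j + Y H n i j) - (Y (U k) n i j + Y (Y H) n i j)
    ≡⟨ +-minus-interchange (U k n i j) (Y H n i j) (Y (U k) n i j) (Y (Y H) n i j) ⟩
  (U k n i j - Y (U k) n i j) + (Y H n i j - Y (Y H) n i j)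
    ≡⟨ cong (U k n i j - Y (U k) n i j +_)
            (trans (sym (shift-⊖ 1 1 2 H (Y H) n i j))
            (trans (shift-cong 1 1 2 (G-telescope d (suc r) (trans (sym (ℕP.+-suc (suc r) d)) eq)) n i j)
                   (shift-⊖ 1 1 2 (U k) (shiftY d (U k)) n i j))) ⟩
  (U k n i j - Y (U k) n i j) + (Y (U k) n i j - Y (shiftY d (U k)) n i j)
    ≡⟨ cong (λ v → (U k n i j - Y (U k) n i j) + (Y (U k) n i j - v))
            (trans (shift-shift 1 1 2 d d (d ℕ.+ d) (U k) n i j)
                   (cong (λ c → shift (suc d) (suc d) c (U k) n i j) (cong suc (sym (ℕP.+-suc d d))))) ⟩
  (U k n i j - Y (U k) n i j) + (Y (U k) n i j - shiftY (suc d) (U k) n i j)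
    ≡⟨ cancel (U k n i j) (Y (U k) n i j) (shiftY (suc d) (U k) n i j) ⟩
  U k n i j - shiftY (suc d) (U k) n i j ∎
  where
  Y = shiftY 1
  H = G k (suc (suc r))
  r<k : suc r < k
  r<k = subst (suc r <_) eq (ℕP.m<m+n (suc r) (s≤s z≤n))
  cancel : ∀ a b c → (a - b) + (b - c) ≡ a - c
  cancel = solve-∀

G₀-equation : ∀ d → let k = suc d in
  G k 0 ⊖ shiftY 1 (G k 0) ≈ (U k ⊖ shiftY 1 (U k)) ⊕ shift 1 2 2 (U k ⊖ shiftY d (U k))
G₀-equation d n i j = begin
  G k 0 n i j - Y (G k 0) n i j
    ≡⟨ cong₂ _-_ (G-unfold 0<k n i j)
                 (trans (shift-cong 1 1 2 (G-unfold 0<k) n i j) (shift-⊕ 1 1 2 (U k) (S G₁) n i j)) ⟩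
  (U k n i j + S G₁ n i j) - (Y (U k) n i j + Y (S G₁) n i j)
    ≡⟨ cong (λ v → (U k n i j + S G₁ n i j) - (Y (U k) n i j + v))
            (trans (shift-shift 1 1 2 1 2 2 G₁ n i j) (sym (shift-shift 1 2 2 1 1 2 G₁ n i j))) ⟩
  (U k n i j + S G₁ n i j) - (Y (U k) n i j + S (Y G₁) n i j)
    ≡⟨ +-minus-interchange (U k n i j) (S G₁ n i j) (Y (U k) n i j) (S (Y G₁) n i j) ⟩
  (U k n i j - Y (U k) n i j) + (S G₁ n i j - S (Y G₁) n i j)
    ≡⟨ cong (U k n i j - Y (U k) n i j +_)
            (trans (sym (shift-⊖ 1 2 2 G₁ (Y G₁) n i j)) (shift-cong 1 2 2 (G-telescope d 0 refl) n i j)) ⟩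
  (U k n i j - Y (U k) n i j) + S (U k ⊖ shiftY d (U k)) n i j ∎
  where
  k = suc d
  Y = shiftY 1
  S = shift 1 2 2
  G₁ = G k 1
  0<k : 0 < k
  0<k = s≤s z≤n

shift-p : ∀ a b c → shift a b c (mono 0 1 0) ≈ mono a (suc b) c
shift-p a b c n i j =
  trans (shift-mono a b c 0 1 0 n i j) (mono-at (ℕP.+-identityʳ a) (ℕP.+-comm b 1) (ℕP.+-identityʳ c) n i j)

shift-G₀ : ∀ {k} → 0 < k → ∀ a b c → shift a b c (G k 0) ≈ shift a b c (F k) ⊕ mono a (suc b) c
shift-G₀ {k} 0<k a b c n i j =
  trans (shift-cong a b c (G≈F⊕p 0<k) n i j)
        (trans (shift-⊕ a b c (F k) (mono 0 1 0) n i j) (cong (shift a b c (F k) n i j +_) (shift-p a b c n i j)))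

shift-U : ∀ {k} → 0 < k → ∀ a b c →
  shift a b c (U k)
    ≈ mono a (suc b) c ⊕ (shift (suc a) (suc b) (suc c) (F k) ⊕ mono (suc a) (suc (suc b)) (suc c))
shift-U {k} 0<k a b c n i j =
  trans (shift-⊕ a b c (mono 0 1 0) (shift 1 1 1 (G k 0)) n i j)
        (cong₂ _+_ (shift-p a b c n i j)
                   (trans (shift-shift a b c 1 1 1 (G k 0) n i j)
                   (trans (shift-at (G k 0) n i j (ℕP.+-comm a 1) (ℕP.+-comm b 1) (ℕP.+-comm c 1))
                          (shift-G₀ 0<k (suc a) (suc b) (suc c) n i j))))

shift-shiftY-U : ∀ d → let k = suc d in
  shift 1 2 2 (shiftY d (U k))
    ≈ mono k (2 ℕ.+ k) (2 ℕ.* k)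
      ⊕ (shift (k ℕ.+ 1) (k ℕ.+ 2) (2 ℕ.* k ℕ.+ 1) (F k) ⊕ mono (k ℕ.+ 1) (2 ℕ.+ (k ℕ.+ 1)) (2 ℕ.* k ℕ.+ 1))
shift-shiftY-U d n i j =
  trans (shift-shift 1 2 2 d d (d ℕ.+ d) (U k) n i j)
  (trans (shift-U 0<k (suc d) (suc (suc d)) (suc (suc (d ℕ.+ d))) n i j)
         (cong₂ _+_ (cong (λ c → mono k (2 ℕ.+ k) c n i j) 2k)
                    (cong₂ _+_ (shift-at (F k) n i j k+1 k+2 2k+1)
                               (mono-at k+1 (cong (2 ℕ.+_) k+1) 2k+1 n i j))))
  where
  k = suc d
  0<k : 0 < k
  0<k = s≤s z≤n
  2k : suc (suc (d ℕ.+ d)) ≡ 2 ℕ.* k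
  2k = sym (trans (cong (k ℕ.+_) (ℕP.+-identityʳ k)) (cong suc (ℕP.+-suc d d)))
  k+1 : suc (suc d) ≡ k ℕ.+ 1
  k+1 = ℕP.+-comm 1 k
  k+2 : suc (suc (suc d)) ≡ k ℕ.+ 2
  k+2 = ℕP.+-comm 2 k
  2k+1 : suc (suc (suc (d ℕ.+ d))) ≡ 2 ℕ.* k ℕ.+ 1
  2k+1 = trans (cong suc 2k) (ℕP.+-comm 1 (2 ℕ.* k))

G₀-equation-in-F : ∀ d → let k = suc d in
  F k ⊕ mono 0 1 0 ⊖ (shift 1 1 2 (F k) ⊕ mono 1 2 2)
    ≈ mono 0 1 0 ⊕ (shift 1 1 1 (F k) ⊕ mono 1 2 1) ⊖ (mono 1 2 2 ⊕ (shift 2 2 3 (F k) ⊕ mono 2 3 3))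
      ⊕ (mono 1 3 2 ⊕ (shift 2 3 3 (F k) ⊕ mono 2 4 3)
         ⊖ (mono k (2 ℕ.+ k) (2 ℕ.* k)
            ⊕ (shift (k ℕ.+ 1) (k ℕ.+ 2) (2 ℕ.* k ℕ.+ 1) (F k) ⊕ mono (k ℕ.+ 1) (2 ℕ.+ (k ℕ.+ 1)) (2 ℕ.* k ℕ.+ 1))))
G₀-equation-in-F d n i j = begin
  F k n i j + mono 0 1 0 n i j - (shift 1 1 2 (F k) n i j + mono 1 2 2 n i j)
    ≡⟨ cong₂ _-_ (sym (G≈F⊕p 0<k n i j)) (sym (shift-G₀ 0<k 1 1 2 n i j)) ⟩
  G k 0 n i j - shiftY 1 (G k 0) n i j
    ≡⟨ G₀-equation d n i j ⟩
  U k n i j - shiftY 1 (U k) n i j + shift 1 2 2 (U k ⊖ shiftY d (U k)) n i j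
    ≡⟨ cong (U k n i j - shiftY 1 (U k) n i j +_) (shift-⊖ 1 2 2 (U k) (shiftY d (U k)) n i j) ⟩
  U k n i j - shiftY 1 (U k) n i j + (shift 1 2 2 (U k) n i j - shift 1 2 2 (shiftY d (U k)) n i j)
    ≡⟨ cong₂ _+_ (cong₂ _-_ (shift-U 0<k 0 0 0 n i j) (shift-U 0<k 1 1 2 n i j))
                 (cong₂ _-_ (shift-U 0<k 1 2 2 n i j) (shift-shiftY-U d n i j)) ⟩
  _ ∎
  where
  k = suc d
  0<k : 0 < k
  0<k = s≤s z≤n

-- turns G₀-equation-in-F, read at one coefficient, into DenPoly k · F k = ⟦ NumPoly k ⟧
rearrange : ∀ f₀ f₁ f₂ f₃ f₄ f₅ m₀ m₁ m₂ m₃ m₄ m₅ m₆ m₇ →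
  f₀ + m₀ - (f₂ + m₇) ≡ (m₀ + (f₁ + m₁) - (m₇ + (f₃ + m₃))) + (m₂ + (f₄ + m₄) - (m₅ + (f₅ + m₆))) →
  f₀ - (f₁ + f₂) + (f₃ - f₄) + f₅ ≡ m₁ + m₂ - (m₃ - m₄) - m₅ - m₆
rearrange f₀ f₁ f₂ f₃ f₄ f₅ m₀ m₁ m₂ m₃ m₄ m₅ m₆ m₇ eq =
  ℤP.i-j≡0⇒i≡j _ _ (trans (difference f₀ f₁ f₂ f₃ f₄ f₅ m₀ m₁ m₂ m₃ m₄ m₅ m₆ m₇) (ℤP.i≡j⇒i-j≡0 eq))
  where
  difference : ∀ f₀ f₁ f₂ f₃ f₄ f₅ m₀ m₁ m₂ m₃ m₄ m₅ m₆ m₇ →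
    (f₀ - (f₁ + f₂) + (f₃ - f₄) + f₅) - (m₁ + m₂ - (m₃ - m₄) - m₅ - m₆)
      ≡ (f₀ + m₀ - (f₂ + m₇)) - ((m₀ + (f₁ + m₁) - (m₇ + (f₃ + m₃))) + (m₂ + (f₄ + m₄) - (m₅ + (f₅ + m₆))))
  difference = solve-∀

Den⊛F≈Num : ∀ d → Den (suc d) ⊛ F (suc d) ≈ Num (suc d)
Den⊛F≈Num d n i j = begin
  (Den k ⊛ F k) n i j
    ≡⟨ Den-⊛ k (F k) n i j ⟩
  (DenPoly k · F k) n i j
    ≡⟨ rearrange (F k n i j) (f 1 1 1) (f 1 1 2) (f 2 2 3) (f 2 3 3) (f (k ℕ.+ 1) (k ℕ.+ 2) (2 ℕ.* k ℕ.+ 1))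
                 (m 0 1 0) (m 1 2 1) (m 1 3 2) (m 2 3 3) (m 2 4 3) (m k (2 ℕ.+ k) (2 ℕ.* k))
                 (m (k ℕ.+ 1) (2 ℕ.+ (k ℕ.+ 1)) (2 ℕ.* k ℕ.+ 1)) (m 1 2 2) (G₀-equation-in-F d n i j) ⟩
  ⟦ NumPoly k ⟧ n i j
    ≡⟨ sym (Num≈ k n i j) ⟩
  Num k n i j ∎
  where
  k = suc d
  f m : ℕ → ℕ → ℕ → ℤ
  f a b c = shift a b c (F k) n i j
  m a b c = mono a b c n i j

theorem1p1 : (k : ℕ) → k ≥ 2 →
    (n i j : ℕ) → (Den k ⊛ F k) n i j ≡ Num k n i j
-- k ≥ 2 only serves to exclude k = 0
theorem1p1 zero    ()
theorem1p1 (suc d) _ = Den⊛F≈Num d
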